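{- Let $AV_n(2+2)$ be the set of interval orders $P$ on $[n]=\{1,\dots,n\}$ for which the identity map is an admissible labelling, regarded as subsets of $[n]\times[n]$ and ordered by $P_1\leq_T P_2$ iff $P_1\supseteq P_2$; this is a lattice with meet $P_1\wedge P_2=P_1\cup P_2$ and join $P_1\vee P_2=\bigcup\{P\in AV_n(2+2): P\subseteq P_1\cap P_2\}$. Let $AV_n(2+2,N)$ be the subset of those $P\in AV_n(2+2)$ with no induced subposet isomorphic to $N$. Then for every $n\in\mathbf{N}$, $AV_n(2+2,N)$ is a meet subsemilattice of $AV_n(2+2)$ (i.e. $P_1\cup P_2\in AV_n(2+2,N)$ whenever $P_1,P_2\in AV_n(2+2,N)$), but in general it is not a join subsemilattice (there is some $n$, e.g. $n=4$, and $P_1,P_2\in AV_n(2+2,N)$ whose join in $AV_n(2+2)$ is not in $AV_n(2+2,N)$).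
   Context: An interval order is a finite poset with no induced subposet isomorphic to $2+2$ (the disjoint union of two 2-element chains). $N$ is the 4-element fence: elements $a,b,c,d$ with $a<c$, $b<c$, $b<d$ and no other strict relations. For a poset $P=(X,\leq)$ and $x\in X$, $I(x)=\{z: z<x\}$, $F(x)=\{z: z>x\}$ (strict), and $x\sim y$ means $I(x)=I(y)$ and $F(x)=F(y)$. A linear extension is a bijection $\lambda:X\to\{1,\dots,|X|\}$ with $x<y\Rightarrow\lambda(x)<\lambda(y)$; it is an admissible labelling if for all $x,y$ with $\lambda(x)<\lambda(y)$, either $I(x)\subset I(y)$, or ($I(x)=I(y)$ and $F(x)\subset F(y)$), or $x\sim y$. -}

module Defs where

open import Data.Nat using (ℕ)
open import Data.Fin using (Fin; toℕ)
import Data.Fin as F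
open import Data.Bool using (Bool; T; _∨_)
open import Data.Product using (Σ; _×_; ∃-syntax)
open import Data.Sum using (_⊎_)
open import Relation.Nullary using (¬_)
open import Relation.Binary.PropositionalEquality using (_≡_; _≢_)

-- A (decidable) relation on [n] = Fin n, i.e. a subset of [n] × [n].
-- Fin n with toℕ plays the role of [n] = {1,…,n} (shifted by one).
BRel : ℕ → Set
BRel n = Fin n → Fin n → Bool

⟦_⟧ : ∀ {n} → BRel n → Fin n → Fin n → Set
⟦ P ⟧ x y = T (P x y)

_∪_ : ∀ {n} → BRel n → BRel n → BRel n
(P ∪ Q) x y = P x y ∨ Q x y

module _ {n : ℕ} (_≤_ : Fin n → Fin n → Set) where

  IsPoset : Set
  IsPoset = (∀ x → x ≤ x)
          × (∀ x y → x ≤ y → y ≤ x → x ≡ y)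
          × (∀ x y z → x ≤ y → y ≤ z → x ≤ z)

  _<_ : Fin n → Fin n → Set
  x < y = (x ≤ y) × (x ≢ y)

  Incomp : Fin n → Fin n → Set
  Incomp x y = ¬ (x ≤ y) × ¬ (y ≤ x)

  TwoPlusTwoFree : Set
  TwoPlusTwoFree = ¬ (Σ (Fin n) λ a → Σ (Fin n) λ b → Σ (Fin n) λ c → Σ (Fin n) λ d →
      (a < b) × (c < d) × Incomp a c × Incomp a d × Incomp b c × Incomp b d)

  NFree : Set
  NFree = ¬ (Σ (Fin n) λ a → Σ (Fin n) λ b → Σ (Fin n) λ c → Σ (Fin n) λ d →
      (a < c) × (b < c) × (b < d) × Incomp a b × Incomp a d × Incomp c d)

  SameI : Fin n → Fin n → Set
  SameI x y = ∀ z → (z < x → z < y) × (z < y → z < x)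

  SameF : Fin n → Fin n → Set
  SameF x y = ∀ z → (x < z → y < z) × (y < z → x < z)

  ProperI : Fin n → Fin n → Set
  ProperI x y = (∀ z → z < x → z < y) × ¬ (∀ z → z < y → z < x)

  ProperF : Fin n → Fin n → Set
  ProperF x y = (∀ z → x < z → y < z) × ¬ (∀ z → y < z → x < z)

  Equiv : Fin n → Fin n → Set
  Equiv x y = SameI x y × SameF x y

  IdLinExt : Set
  IdLinExt = ∀ x y → x < y → x F.< y

  IdAdmissible : Set
  IdAdmissible = IdLinExt × (∀ x y → x F.< y →
      ProperI x y ⊎ (SameI x y × ProperF x y) ⊎ Equiv x y)

  AV22 : Set
  AV22 = IsPoset × TwoPlusTwoFree × IdAdmissible

  AV22N : Set
  AV22N = AV22 × NFree

Join : ∀ {n} → BRel n → BRel n → Fin n → Fin n → Set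
Join {n} P₁ P₂ x y = Σ (BRel n) λ Q →
    AV22 ⟦ Q ⟧ × (∀ a b → T (Q a b) → T (P₁ a b) × T (P₂ a b)) × T (Q x y)

-- The identity labelling of a poset on [n] is admissible and N-free exactly
-- when it is a linear extension along which strict down-sets increase, and
-- along which strict up-sets increase between incomparable elements: a down-set
-- failing to grow exhibits a 2+2, an up-set failing to grow a 2+2 or an N, and
-- conversely the two monotonicity conditions exclude both patterns and force
-- admissibility.  These conditions, like being a poset with the identity as a
-- linear extension, are preserved by unions, which gives closure under meets.
-- For joins, already in AV_4(2+2) a common lower bound of two N-free orders can
-- contain an N.
module Submission where

open import Defs
open import Data.Nat using (ℕ)
open import Data.Fin as F using (Fin; _≟_; #_)
import Data.Fin.Properties as FP
open import Data.Bool using (T; _∨_; _∧_)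
open import Data.Bool.Properties using (T-∨)
open import Data.Bool.ListAction using (any)
open import Data.Empty using (⊥; ⊥-elim)
open import Data.List using (List; []; _∷_)
open import Data.Nat using (_≡ᵇ_)
open import Data.Product using (Σ; _×_; _,_; proj₁; proj₂; map₁)
open import Data.Sum using (_⊎_; inj₁; inj₂; [_,_]′) renaming (map to ⊎-map)
open import Data.Unit using (tt)
open import Function using (_∘_; const)
open import Function.Bundles using (Equivalence)
open import Relation.Binary using (Decidable; tri<; tri≈; tri>)
open import Relation.Binary.PropositionalEquality using (_≡_; refl; sym; _≢_)
open import Relation.Nullary using (¬_; Dec; yes; no)
open import Relation.Nullary.Decidable using (T?; ¬?; _×-dec_; _→-dec_; _⊎-dec_; from-yes)

counterexample : ∀ {a b} {A : Set a} {B : Set b} → Dec A → ¬ (A → B) → A × ¬ B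
counterexample (yes a) ¬A⇒B = a , ¬A⇒B ∘ const
counterexample (no ¬a) ¬A⇒B = ⊥-elim (¬A⇒B (⊥-elim ∘ ¬a))

module Order {n : ℕ} (_≤_ : Fin n → Fin n → Set) where

  _⊏_ : Fin n → Fin n → Set
  x ⊏ y = _<_ _≤_ x y

  DownSetsIncrease : Set
  DownSetsIncrease = ∀ x y → x F.< y → ∀ z → z ⊏ x → z ⊏ y

  UpSetsIncrease : Set
  UpSetsIncrease = ∀ x y → x F.< y → ¬ x ⊏ y → ∀ w → x ⊏ w → y ⊏ w

  LabelMonotone : Set
  LabelMonotone = IsPoset _≤_ × IdLinExt _≤_ × DownSetsIncrease × UpSetsIncrease

  Reflexive Transitive : Set
  Reflexive  = ∀ x → x ≤ x
  Transitive = ∀ x y z → x ≤ y → y ≤ z → x ≤ z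

  incomparable : ∀ {x y} → x ≢ y → ¬ x ⊏ y → ¬ y ⊏ x → Incomp _≤_ x y
  incomparable x≢y ¬x⊏y ¬y⊏x = (λ x≤y → ¬x⊏y (x≤y , x≢y)) , (λ y≤x → ¬y⊏x (y≤x , x≢y ∘ sym))

  Incomp-sym : ∀ {x y} → Incomp _≤_ x y → Incomp _≤_ y x
  Incomp-sym (x≰y , y≰x) = y≰x , x≰y

  ⊏-trans : Transitive → IdLinExt _≤_ → ∀ {x y z} → x ⊏ y → y ⊏ z → x ⊏ z
  ⊏-trans trans linExt {x} {y} {z} x⊏y y⊏z =
    trans x y z (proj₁ x⊏y) (proj₁ y⊏z) , FP.<⇒≢ (FP.<-trans (linExt x y x⊏y) (linExt y z y⊏z))

  downSetsIncrease⇒2+2-free : Reflexive → DownSetsIncrease → TwoPlusTwoFree _≤_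
  downSetsIncrease⇒2+2-free refl′ down (a , b , c , d , a⊏b , c⊏d , _ , a∥d , b∥c , b∥d)
    with FP.<-cmp b d
  ... | tri< b<d _ _ = proj₁ a∥d (proj₁ (down b d b<d a a⊏b))
  ... | tri≈ _ refl _ = proj₁ b∥d (refl′ b)
  ... | tri> _ _ d<b = proj₂ b∥c (proj₁ (down d b d<b c c⊏d))

  upSetsIncrease⇒N-free : Reflexive → IdLinExt _≤_ → UpSetsIncrease → NFree _≤_
  upSetsIncrease⇒N-free refl′ linExt up (a , b , c , d , a⊏c , b⊏c , b⊏d , a∥b , a∥d , c∥d)
    with FP.<-cmp a d
  ... | tri< a<d _ _ = proj₂ c∥d (proj₁ (up a d a<d (proj₁ a∥d ∘ proj₁) c a⊏c))
  ... | tri≈ _ refl _ = proj₁ a∥d (refl′ a)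
  ... | tri> _ _ d<a =
    proj₁ a∥d (proj₁ (up b a (FP.<-trans (linExt b d b⊏d) d<a) (proj₂ a∥b ∘ proj₁) d b⊏d))

  module _ (_≤?_ : Decidable _≤_) where

    _⊏?_ : Decidable _⊏_
    x ⊏? y = (x ≤? y) ×-dec ¬? (x ≟ y)

    -- If I(x) ⊂ I(y) is witnessed by z, then x, y, z and any w ∈ F(x) ∖ F(y)
    -- would form an N (when z < w) or a 2+2 (otherwise).
    upSetGrows : Transitive → IdLinExt _≤_ → TwoPlusTwoFree _≤_ → NFree _≤_ →
                 ∀ {x y z w} → x F.< y → ¬ x ⊏ y → z ⊏ y → ¬ z ⊏ x → x ⊏ w → y ⊏ w
    upSetGrows trans linExt 2+2-free N-free {x} {y} {z} {w} x<y ¬x⊏y z⊏y ¬z⊏x x⊏w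
      with y ⊏? w
    ... | yes y⊏w = y⊏w
    ... | no ¬y⊏w = ⊥-elim (N-or-2+2 (z ⊏? w))
      where
      _⨾_ : ∀ {a b c} → a ⊏ b → b ⊏ c → a ⊏ c
      _⨾_ = ⊏-trans trans linExt
      x∥y : Incomp _≤_ x y
      x∥y = incomparable (FP.<⇒≢ x<y) ¬x⊏y (λ y⊏x → FP.<-asym x<y (linExt y x y⊏x))
      y∥w : Incomp _≤_ y w
      y∥w = incomparable (λ { refl → ¬x⊏y x⊏w }) ¬y⊏w (λ w⊏y → ¬x⊏y (x⊏w ⨾ w⊏y))
      z∥x : Incomp _≤_ z x
      z∥x = incomparable (λ { refl → ¬x⊏y z⊏y }) ¬z⊏x (λ x⊏z → ¬x⊏y (x⊏z ⨾ z⊏y))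
      N-or-2+2 : Dec (z ⊏ w) → ⊥
      N-or-2+2 (yes z⊏w) =
        N-free (x , z , w , y , x⊏w , z⊏w , z⊏y , Incomp-sym z∥x , x∥y , Incomp-sym y∥w)
      N-or-2+2 (no ¬z⊏w) =
        2+2-free (z , y , x , w , z⊏y , x⊏w , z∥x , z∥w , Incomp-sym x∥y , y∥w)
        where
        z∥w : Incomp _≤_ z w
        z∥w = incomparable (λ { refl → ¬x⊏y (x⊏w ⨾ z⊏y) }) ¬z⊏w
                (λ w⊏z → ¬x⊏y (x⊏w ⨾ (w⊏z ⨾ z⊏y)))

    AV22N⇒LabelMonotone : AV22N _≤_ → LabelMonotone
    AV22N⇒LabelMonotone ((poset@(_ , _ , trans) , 2+2-free , linExt , admissible) , N-free) =
      poset , linExt , down , up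
      where
      down : DownSetsIncrease
      down x y x<y z z⊏x with admissible x y x<y
      ... | inj₁ (I⊆ , _)             = I⊆ z z⊏x
      ... | inj₂ (inj₁ (sameI , _))   = proj₁ (sameI z) z⊏x
      ... | inj₂ (inj₂ (sameI , _))   = proj₁ (sameI z) z⊏x
      up : UpSetsIncrease
      up x y x<y ¬x⊏y w x⊏w with admissible x y x<y
      ... | inj₂ (inj₁ (_ , F⊆ , _))  = F⊆ w x⊏w
      ... | inj₂ (inj₂ (_ , sameF))   = proj₁ (sameF w) x⊏w
      ... | inj₁ (_ , I⊉) with FP.¬∀⟶∃¬ n _ (λ z → z ⊏? y →-dec z ⊏? x) I⊉
      ... | z , z∉I⊆ with counterexample (z ⊏? y) z∉I⊆
      ... | z⊏y , ¬z⊏x = upSetGrows trans linExt 2+2-free N-free x<y ¬x⊏y z⊏y ¬z⊏x x⊏w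

    labelMonotone⇒admissible : IdLinExt _≤_ → DownSetsIncrease → UpSetsIncrease → IdAdmissible _≤_
    labelMonotone⇒admissible linExt down up = linExt , compare
      where
      compare : ∀ x y → x F.< y →
                ProperI _≤_ x y ⊎ (SameI _≤_ x y × ProperF _≤_ x y) ⊎ Equiv _≤_ x y
      compare x y x<y with FP.all? (λ z → z ⊏? y →-dec z ⊏? x)
      ... | no I⊉ = inj₁ (down x y x<y , I⊉)
      ... | yes I⊇ = inj₂ (upSetsDecide (FP.all? (λ w → y ⊏? w →-dec x ⊏? w)))
        where
        sameI : SameI _≤_ x y
        sameI z = down x y x<y z , I⊇ z
        F⊆ : ∀ w → x ⊏ w → y ⊏ w
        F⊆ = up x y x<y (λ x⊏y → proj₂ (I⊇ x x⊏y) refl)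
        upSetsDecide : Dec (∀ w → y ⊏ w → x ⊏ w) → SameI _≤_ x y × ProperF _≤_ x y ⊎ Equiv _≤_ x y
        upSetsDecide (no F⊉)  = inj₁ (sameI , F⊆ , F⊉)
        upSetsDecide (yes F⊇) = inj₂ (sameI , λ w → F⊆ w , F⊇ w)

    LabelMonotone⇒AV22N : LabelMonotone → AV22N _≤_
    LabelMonotone⇒AV22N (poset@(refl′ , _) , linExt , down , up) =
      (poset , downSetsIncrease⇒2+2-free refl′ down , labelMonotone⇒admissible linExt down up)
      , upSetsIncrease⇒N-free refl′ linExt up

    isPoset? : Dec (IsPoset _≤_)
    isPoset? = all? (λ x → x ≤? x)
      ×-dec (all? λ x → all? λ y → x ≤? y →-dec y ≤? x →-dec x ≟ y)
      ×-dec (all? λ x → all? λ y → all? λ z → x ≤? y →-dec y ≤? z →-dec x ≤? z)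
      where all? = FP.all?

    incomp? : Decidable (Incomp _≤_)
    incomp? x y = ¬? (x ≤? y) ×-dec ¬? (y ≤? x)

    twoPlusTwoFree? : Dec (TwoPlusTwoFree _≤_)
    twoPlusTwoFree? = ¬? (any? λ a → any? λ b → any? λ c → any? λ d →
      a ⊏? b ×-dec c ⊏? d ×-dec incomp? a c ×-dec incomp? a d ×-dec incomp? b c ×-dec incomp? b d)
      where any? = FP.any?

    NFree? : Dec (NFree _≤_)
    NFree? = ¬? (any? λ a → any? λ b → any? λ c → any? λ d →
      a ⊏? c ×-dec b ⊏? c ×-dec b ⊏? d ×-dec incomp? a b ×-dec incomp? a d ×-dec incomp? c d)
      where any? = FP.any?

    idAdmissible? : Dec (IdAdmissible _≤_)
    idAdmissible? =
      (all? λ x → all? λ y → x ⊏? y →-dec x FP.<? y)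
      ×-dec (all? λ x → all? λ y → x FP.<? y →-dec
               (properI? x y ⊎-dec (sameI? x y ×-dec properF? x y) ⊎-dec (sameI? x y ×-dec sameF? x y)))
      where
      all? = FP.all?
      ⊆I? : ∀ x y → Dec (∀ z → z ⊏ x → z ⊏ y)
      ⊆F? : ∀ x y → Dec (∀ z → x ⊏ z → y ⊏ z)
      ⊆I? x y = all? λ z → z ⊏? x →-dec z ⊏? y
      ⊆F? x y = all? λ z → x ⊏? z →-dec y ⊏? z
      sameI? : Decidable (SameI _≤_)
      sameF? : Decidable (SameF _≤_)
      properI? : Decidable (ProperI _≤_)
      properF? : Decidable (ProperF _≤_)
      sameI? x y   = all? λ z → (z ⊏? x →-dec z ⊏? y) ×-dec (z ⊏? y →-dec z ⊏? x)
      sameF? x y   = all? λ z → (x ⊏? z →-dec y ⊏? z) ×-dec (y ⊏? z →-dec x ⊏? z)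
      properI? x y = ⊆I? x y ×-dec ¬? (⊆I? y x)
      properF? x y = ⊆F? x y ×-dec ¬? (⊆F? y x)

    AV22? : Dec (AV22 _≤_)
    AV22? = isPoset? ×-dec twoPlusTwoFree? ×-dec idAdmissible?

    AV22N? : Dec (AV22N _≤_)
    AV22N? = AV22? ×-dec NFree?

open Order using (LabelMonotone; DownSetsIncrease; UpSetsIncrease; Transitive)

module _ {n : ℕ} {P Q : BRel n} where

  ∪-introˡ : ∀ {x y} → ⟦ P ⟧ x y → ⟦ P ∪ Q ⟧ x y
  ∪-introˡ = Equivalence.from T-∨ ∘ inj₁

  ∪-introʳ : ∀ {x y} → ⟦ Q ⟧ x y → ⟦ P ∪ Q ⟧ x y
  ∪-introʳ = Equivalence.from T-∨ ∘ inj₂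

  ∪-elim : ∀ {x y} → ⟦ P ∪ Q ⟧ x y → ⟦ P ⟧ x y ⊎ ⟦ Q ⟧ x y
  ∪-elim = Equivalence.to T-∨

  ⊏-∪ˡ : ∀ {x y} → _<_ ⟦ P ⟧ x y → _<_ ⟦ P ∪ Q ⟧ x y
  ⊏-∪ˡ = map₁ ∪-introˡ

  ⊏-∪ʳ : ∀ {x y} → _<_ ⟦ Q ⟧ x y → _<_ ⟦ P ∪ Q ⟧ x y
  ⊏-∪ʳ = map₁ ∪-introʳ

  ⊏-∪-elim : ∀ {x y} → _<_ ⟦ P ∪ Q ⟧ x y → _<_ ⟦ P ⟧ x y ⊎ _<_ ⟦ Q ⟧ x y
  ⊏-∪-elim (x≤y , x≢y) = ⊎-map (_, x≢y) (_, x≢y) (∪-elim x≤y)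

  LabelMonotone-∪ : LabelMonotone ⟦ P ⟧ → LabelMonotone ⟦ Q ⟧ → LabelMonotone ⟦ P ∪ Q ⟧
  LabelMonotone-∪ ((refl₁ , _ , trans₁) , linExt₁ , down₁ , up₁)
                  ((_ , _ , trans₂) , linExt₂ , down₂ , up₂) =
    (∪-introˡ ∘ refl₁ , antisym , trans) , linExt , down , up
    where
    linExt : IdLinExt ⟦ P ∪ Q ⟧
    linExt x y x⊏y = [ linExt₁ x y , linExt₂ x y ]′ (⊏-∪-elim x⊏y)

    antisym : ∀ x y → ⟦ P ∪ Q ⟧ x y → ⟦ P ∪ Q ⟧ y x → x ≡ y
    antisym x y x≤y y≤x with x ≟ y
    ... | yes x≡y = x≡y
    ... | no x≢y  = ⊥-elim (FP.<-asym (linExt x y (x≤y , x≢y)) (linExt y x (y≤x , x≢y ∘ sym)))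

    -- In a mixed chain x ≤₁ y ≤₂ z the label of y is below that of z, so
    -- I₁(y) ⊆ I₁(z) puts x ≤₁ z.
    trans : Transitive ⟦ P ∪ Q ⟧
    trans x y z x≤y y≤z with x ≟ y | y ≟ z
    ... | yes refl | _        = y≤z
    ... | no _     | yes refl = x≤y
    ... | no x≢y   | no y≢z with ∪-elim x≤y | ∪-elim y≤z
    ... | inj₁ x≤₁y | inj₁ y≤₁z = ∪-introˡ (trans₁ x y z x≤₁y y≤₁z)
    ... | inj₂ x≤₂y | inj₂ y≤₂z = ∪-introʳ (trans₂ x y z x≤₂y y≤₂z)
    ... | inj₁ x≤₁y | inj₂ y≤₂z =
      ∪-introˡ (proj₁ (down₁ y z (linExt₂ y z (y≤₂z , y≢z)) x (x≤₁y , x≢y)))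
    ... | inj₂ x≤₂y | inj₁ y≤₁z =
      ∪-introʳ (proj₁ (down₂ y z (linExt₁ y z (y≤₁z , y≢z)) x (x≤₂y , x≢y)))

    down : DownSetsIncrease ⟦ P ∪ Q ⟧
    down x y x<y z z⊏x = [ ⊏-∪ˡ ∘ down₁ x y x<y z , ⊏-∪ʳ ∘ down₂ x y x<y z ]′ (⊏-∪-elim z⊏x)

    up : UpSetsIncrease ⟦ P ∪ Q ⟧
    up x y x<y ¬x⊏y w x⊏w =
      [ ⊏-∪ˡ ∘ up₁ x y x<y (¬x⊏y ∘ ⊏-∪ˡ) w , ⊏-∪ʳ ∘ up₂ x y x<y (¬x⊏y ∘ ⊏-∪ʳ) w ]′ (⊏-∪-elim x⊏w)

⟦_⟧? : ∀ {n} (P : BRel n) → Decidable ⟦ P ⟧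
⟦ P ⟧? x y = T? (P x y)

AV22N-∪ : ∀ {n} {P Q : BRel n} → AV22N ⟦ P ⟧ → AV22N ⟦ Q ⟧ → AV22N ⟦ P ∪ Q ⟧
AV22N-∪ {P = P} {Q} P∈AV Q∈AV = Order.LabelMonotone⇒AV22N _ ⟦ P ∪ Q ⟧?
  (LabelMonotone-∪ (Order.AV22N⇒LabelMonotone _ ⟦ P ⟧? P∈AV) (Order.AV22N⇒LabelMonotone _ ⟦ Q ⟧? Q∈AV))

module _ {n : ℕ} {P₁ P₂ : BRel n} where

  Join⇒both : ∀ {x y} → Join P₁ P₂ x y → T (P₁ x y) × T (P₂ x y)
  Join⇒both (_ , _ , Q⊆P₁∩P₂ , Qxy) = Q⊆P₁∩P₂ _ _ Qxy

  ⊆Join : ∀ {Q} → AV22 ⟦ Q ⟧ → (∀ a b → T (Q a b) → T (P₁ a b) × T (P₂ a b)) →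
          ∀ {x y} → T (Q x y) → Join P₁ P₂ x y
  ⊆Join {Q} Q∈AV Q⊆P₁∩P₂ Qxy = Q , Q∈AV , Q⊆P₁∩P₂ , Qxy

reflexiveClosure : ∀ {n} → List (ℕ × ℕ) → BRel n
reflexiveClosure pairs x y =
  (F.toℕ x ≡ᵇ F.toℕ y) ∨ any (λ (i , j) → (i ≡ᵇ F.toℕ x) ∧ (j ≡ᵇ F.toℕ y)) pairs

-- Q ⊆ R₁ ∩ R₂ lies in AV₄(2+2) and contains the N  0 < 3 > 1 < 2, whose three
-- incomparable pairs are each missing from R₁ or from R₂.
R₁ R₂ Q : BRel 4
R₁ = reflexiveClosure ((0 , 3) ∷ (1 , 2) ∷ (1 , 3) ∷ (2 , 3) ∷ [])
R₂ = reflexiveClosure ((0 , 2) ∷ (0 , 3) ∷ (1 , 2) ∷ (1 , 3) ∷ [])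
Q  = reflexiveClosure ((0 , 3) ∷ (1 , 2) ∷ (1 , 3) ∷ [])

R₁∈AV22N : AV22N ⟦ R₁ ⟧
R₁∈AV22N = from-yes (Order.AV22N? _ ⟦ R₁ ⟧?)

R₂∈AV22N : AV22N ⟦ R₂ ⟧
R₂∈AV22N = from-yes (Order.AV22N? _ ⟦ R₂ ⟧?)

Q∈AV22 : AV22 ⟦ Q ⟧
Q∈AV22 = from-yes (Order.AV22? _ ⟦ Q ⟧?)

Q⊆R₁∩R₂ : ∀ a b → T (Q a b) → T (R₁ a b) × T (R₂ a b)
Q⊆R₁∩R₂ = from-yes (FP.all? λ a → FP.all? λ b → T? (Q a b) →-dec T? (R₁ a b) ×-dec T? (R₂ a b))

Join-not-NFree : ¬ NFree (Join R₁ R₂)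
Join-not-NFree N-free = N-free (# 0 , # 1 , # 3 , # 2
  , (inQ tt , λ ()) , (inQ tt , λ ()) , (inQ tt , λ ())
  , (⊆R₁ , ⊆R₁) , (⊆R₁ , ⊆R₁) , (⊆R₁ , proj₂ ∘ Join⇒both))
  where
  inQ : ∀ {x y} → T (Q x y) → Join R₁ R₂ x y
  inQ = ⊆Join Q∈AV22 Q⊆R₁∩R₂
  ⊆R₁ : ∀ {x y} → Join R₁ R₂ x y → T (R₁ x y)
  ⊆R₁ = proj₁ ∘ Join⇒both

mainTheorem9 : ((n : ℕ) (P₁ P₂ : BRel n) → AV22N ⟦ P₁ ⟧ → AV22N ⟦ P₂ ⟧ → AV22N ⟦ P₁ ∪ P₂ ⟧)
    × (Σ ℕ λ n → Σ (BRel n) λ P₁ → Σ (BRel n) λ P₂ →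
         AV22N ⟦ P₁ ⟧ × AV22N ⟦ P₂ ⟧ × ¬ AV22N (Join P₁ P₂))
mainTheorem9 = (λ _ _ _ → AV22N-∪) , 4 , R₁ , R₂ , R₁∈AV22N , R₂∈AV22N , Join-not-NFree ∘ proj₂
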